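{- A modal Nelson lattice $\mathbf{N}=\langle\mathbf{A},\blacksquare,\Diamond_N\rangle$ satisfies the equation $\Delta x=\nabla x$ if and only if there exists a modal Heyting algebra $\mathbf{M}=\langle\mathbf{H},\square,\Diamond\rangle$ satisfying $--\square a=-\Diamond -a$ and $-\square -a=--\Diamond a$ for all $a\in H$, such that $\mathbf{N}$ is isomorphic to $\mathbf{N}(\mathbf{M},D(\mathbf{H}))$.
   Context: A Nelson lattice is an involutive residuated lattice $\langle A,\wedge,\vee,*,\Rightarrow,\top,\bot\rangle$ ($\sim a=a\Rightarrow\bot$, $\sim\sim a=a$, $a^2=a*a$) satisfying $((a^2\Rightarrow b)\wedge((\sim b)^2\Rightarrow\sim a))\Rightarrow(a\Rightarrow b)=\top$. A modal Nelson lattice is $\langle\mathbf{A},\blacksquare,\Diamond_N\rangle$ (here $\Diamond_N$ denotes the Nelson-level diamond, written as a black lozenge in the paper) with $\mathbf{A}$ a Nelson lattice such that for all $a,b$: $\Diamond_N a=\sim\blacksquare\sim a$; if $a^2=b^2$ then $(\blacksquare a)^2=(\blacksquare b)^2$ and $(\Diamond_N a)^2=(\Diamond_N b)^2$; and $(\blacksquare a\wedge\Diamond_N(\sim a^2\wedge b))^2=\bot$. The term operations are $\nabla(x)=\sim(\sim x^2)^2$ and $\Delta(x)=(\sim(\sim x)^2)^2$. A modal Heyting algebra is $\langle\mathbf{H},\square,\Diamond\rangle$ with $\mathbf{H}$ a Heyting algebra ($-a=a\rightharpoonup\bot$) and unary $\square,\Diamond$ satisfying $\square a\wedge\Diamond(-a\wedge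 b)=\bot$. $D(\mathbf{H})=\{a\in H:-a=\bot\}$ is the filter of dense elements. $\mathbf{N}(\mathbf{M},D(\mathbf{H}))$ is the twist structure on $\{(x,y)\in H\times H:x\wedge y=\bot,\ x\vee y\in D(\mathbf{H})\}$ with $(x,y)\vee(s,t)=(x\vee s,y\wedge t)$, $(x,y)\wedge(s,t)=(x\wedge s,y\vee t)$, $(x,y)*(s,t)=(x\wedge s,(x\rightharpoonup t)\wedge(s\rightharpoonup y))$, $(x,y)\Rightarrow(s,t)=((x\rightharpoonup s)\wedge(t\rightharpoonup y),x\wedge t)$, $\top=(\top,\bot)$, $\bot=(\bot,\top)$, $\blacksquare(x,y)=(\square x,\Diamond y)$, $\Diamond_N(x,y)=(\Diamond x,\square y)$. -}

module Defs where

open import Level using (Level; _⊔_; suc)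
open import Data.Product using (Σ; _×_; _,_; proj₁; proj₂; ∃)
open import Relation.Binary.Core using (Rel)
open import Algebra.Core using (Op₁; Op₂)
open import Algebra.Definitions using (Congruent₁; Congruent₂)
open import Algebra.Structures using (IsCommutativeMonoid)
open import Algebra.Lattice.Structures using (IsLattice)
open import Relation.Binary.Lattice.Bundles using (HeytingAlgebra)

-- An (involutive, commutative, integral, bounded) residuated lattice
-- ⟨A, ∧, ∨, *, ⇒, ⊤, ⊥⟩ presented as a setoid-based algebra.
-- The lattice order is  a ≤ b  :⇔  a ∧ b ≈ a.

record NelsonLattice (c ℓ : Level) : Set (suc (c ⊔ ℓ)) where
  infix  4 _≈_
  infixr 5 _⇒_
  infixr 6 _∨_
  infixr 7 _∧_
  infixr 8 _*_
  field
    Carrier   : Set c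
    _≈_       : Rel Carrier ℓ
    _∧_       : Op₂ Carrier
    _∨_       : Op₂ Carrier
    _*_       : Op₂ Carrier
    _⇒_       : Op₂ Carrier
    ⊤         : Carrier
    ⊥         : Carrier
    isLattice : IsLattice _≈_ _∨_ _∧_
    *-isCommutativeMonoid : IsCommutativeMonoid _≈_ _*_ ⊤
    ⇒-cong    : Congruent₂ _≈_ _⇒_
    ⊤-max     : ∀ a → (a ∧ ⊤) ≈ a
    ⊥-min     : ∀ a → (⊥ ∧ a) ≈ ⊥
    -- residuation:  a * b ≤ c  ⇔  a ≤ b ⇒ c
    residuation₁ : ∀ a b c → ((a * b) ∧ c) ≈ (a * b) → (a ∧ (b ⇒ c)) ≈ a
    residuation₂ : ∀ a b c → (a ∧ (b ⇒ c)) ≈ a → ((a * b) ∧ c) ≈ (a * b)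
    involutive : ∀ a → ((a ⇒ ⊥) ⇒ ⊥) ≈ a
    nelson    : ∀ a b →
      (((a * a) ⇒ b) ∧ (((b ⇒ ⊥) * (b ⇒ ⊥)) ⇒ (a ⇒ ⊥))) ⇒ (a ⇒ b) ≈ ⊤

  ∼_ : Op₁ Carrier
  ∼ a = a ⇒ ⊥

  sq : Op₁ Carrier
  sq a = a * a

record ModalNelsonLattice (c ℓ : Level) : Set (suc (c ⊔ ℓ)) where
  field
    nelsonLattice : NelsonLattice c ℓ
  open NelsonLattice nelsonLattice public
  field
    ■ : Op₁ Carrier
    ◆ : Op₁ Carrier
    ■-cong : Congruent₁ _≈_ ■
    ◆-cong : Congruent₁ _≈_ ◆
    ◆-def  : ∀ a → ◆ a ≈ ∼ ■ (∼ a)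
    ■-sq   : ∀ a b → sq a ≈ sq b → sq (■ a) ≈ sq (■ b)
    ◆-sq   : ∀ a b → sq a ≈ sq b → sq (◆ a) ≈ sq (◆ b)
    modal  : ∀ a b → sq (■ a ∧ ◆ ((∼ sq a) ∧ b)) ≈ ⊥

  ∇ : Op₁ Carrier
  ∇ x = ∼ sq (∼ sq x)

  Δ : Op₁ Carrier
  Δ x = sq (∼ sq (∼ x))

record ModalHeytingAlgebra (c ℓ₁ ℓ₂ : Level) : Set (suc (c ⊔ ℓ₁ ⊔ ℓ₂)) where
  field
    heytingAlgebra : HeytingAlgebra c ℓ₁ ℓ₂
  open HeytingAlgebra heytingAlgebra public
  field
    □ : Op₁ Carrier
    ◇ : Op₁ Carrier
    □-cong : Congruent₁ _≈_ □
    ◇-cong : Congruent₁ _≈_ ◇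
    modal  : ∀ a b → (□ a ∧ ◇ ((a ⇨ ⊥) ∧ b)) ≈ ⊥

  -_ : Op₁ Carrier
  - a = a ⇨ ⊥

  Dense : Carrier → Set ℓ₁
  Dense a = (- a) ≈ ⊥

module Twist {c ℓ₁ ℓ₂} (M : ModalHeytingAlgebra c ℓ₁ ℓ₂) where
  open ModalHeytingAlgebra M

  Pair : Set c
  Pair = Carrier × Carrier

  InTwist : Pair → Set ℓ₁
  InTwist (x , y) = ((x ∧ y) ≈ ⊥) × Dense (x ∨ y)

  _≈ₜ_ : Pair → Pair → Set ℓ₁
  (x , y) ≈ₜ (s , t) = (x ≈ s) × (y ≈ t)

  _∨ₜ_ : Pair → Pair → Pair
  (x , y) ∨ₜ (s , t) = (x ∨ s , y ∧ t)

  _∧ₜ_ : Pair → Pair → Pair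
  (x , y) ∧ₜ (s , t) = (x ∧ s , y ∨ t)

  _*ₜ_ : Pair → Pair → Pair
  (x , y) *ₜ (s , t) = (x ∧ s , (x ⇨ t) ∧ (s ⇨ y))

  _⇒ₜ_ : Pair → Pair → Pair
  (x , y) ⇒ₜ (s , t) = ((x ⇨ s) ∧ (t ⇨ y) , x ∧ t)

  ⊤ₜ : Pair
  ⊤ₜ = (⊤ , ⊥)

  ⊥ₜ : Pair
  ⊥ₜ = (⊥ , ⊤)

  ■ₜ : Pair → Pair
  ■ₜ (x , y) = (□ x , ◇ y)

  ◆ₜ : Pair → Pair
  ◆ₜ (x , y) = (◇ x , □ y)

record TwistIso {c ℓ c' ℓ₁ ℓ₂}
                (N : ModalNelsonLattice c ℓ)
                (M : ModalHeytingAlgebra c' ℓ₁ ℓ₂)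
                : Set (c ⊔ ℓ ⊔ c' ⊔ ℓ₁) where
  module N = ModalNelsonLattice N
  open Twist M
  field
    f         : N.Carrier → Pair
    f-into    : ∀ a → InTwist (f a)
    f-cong    : ∀ {a b} → a N.≈ b → f a ≈ₜ f b
    f-inj     : ∀ {a b} → f a ≈ₜ f b → a N.≈ b
    f-surj    : ∀ p → InTwist p → ∃ λ a → f a ≈ₜ p
    f-∧       : ∀ a b → f (a N.∧ b) ≈ₜ (f a ∧ₜ f b)
    f-∨       : ∀ a b → f (a N.∨ b) ≈ₜ (f a ∨ₜ f b)
    f-*       : ∀ a b → f (a N.* b) ≈ₜ (f a *ₜ f b)
    f-⇒       : ∀ a b → f (a N.⇒ b) ≈ₜ (f a ⇒ₜ f b)
    f-⊤       : f N.⊤ ≈ₜ ⊤ₜ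
    f-⊥       : f N.⊥ ≈ₜ ⊥ₜ
    f-■       : ∀ a → f (N.■ a) ≈ₜ ■ₜ (f a)
    f-◆       : ∀ a → f (N.◆ a) ≈ₜ ◆ₜ (f a)

Theorem9Conditions : ∀ {c ℓ₁ ℓ₂} → ModalHeytingAlgebra c ℓ₁ ℓ₂ → Set (c ⊔ ℓ₁)
Theorem9Conditions M =
  (∀ a → (- (- □ a)) ≈ (- ◇ (- a))) × (∀ a → (- □ (- a)) ≈ (- (- ◇ a)))
  where open ModalHeytingAlgebra M

SatisfiesΔ≈∇ : ∀ {c ℓ} → ModalNelsonLattice c ℓ → Set (c ⊔ ℓ)
SatisfiesΔ≈∇ N = ∀ x → Δ x ≈ ∇ x
  where open ModalNelsonLattice N

-- In a twist structure N(M, D(H)) the terms Δ and ∇ send (x, y) to (−y, −−y) and (−−x, −x);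
-- these agree because x ∧ y = ⊥ with x ∨ y dense forces −−x = −y, and an isomorphism carries
-- the identity back to N.
-- Conversely, the Nelson axiom makes A 3-potent, so that the quotient H of A by a² = b² is a
-- Heyting algebra (with a ⇒ₕ b = a² ⇒ b) on which ■ and ◆ are well defined, and it makes
-- a ↦ (a, ∼a) injective. In H, Δa = ∇a says exactly −∼a = −−a, i.e. that a ∨ ∼a is dense, so
-- a ↦ (a, ∼a) is an isomorphism onto N(M, D(H)); the same identity at ■a² and at ∼■∼a² gives the
-- two conditions on M.

module Submission where

open import Defs
open import Data.Product using (Σ; ∃; _×_; _,_)
open import Function.Base using (_on_)
open import Function.Bundles using (_⇔_; mk⇔)
open import Algebra.Bundles using (CommutativeMonoid)
import Algebra.Properties.CommutativeSemigroup as CommutativeSemigroupProperties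
open import Algebra.Lattice.Bundles using (Lattice)
open import Algebra.Lattice.Properties.Lattice using (∨-∧-orderTheoreticLattice)
import Relation.Binary.Lattice as Ord
open import Relation.Binary.Bundles using (Setoid)
import Relation.Binary.Construct.On as On
open import Data.Product.Relation.Binary.Pointwise.NonDependent using (×-setoid)
import Relation.Binary.Lattice.Properties.HeytingAlgebra as HeytingAlgebraProperties
import Relation.Binary.Lattice.Properties.MeetSemilattice as MeetSemilatticeProperties
import Relation.Binary.Lattice.Properties.JoinSemilattice as JoinSemilatticeProperties
import Relation.Binary.Lattice.Properties.BoundedMeetSemilattice as BoundedMeetSemilatticeProperties
import Relation.Binary.Lattice.Properties.BoundedJoinSemilattice as BoundedJoinSemilatticeProperties
import Relation.Binary.Reasoning.PartialOrder as PartialOrderReasoning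
import Relation.Binary.Reasoning.Setoid as SetoidReasoning

module HeytingAlgebraLemmas {c ℓ₁ ℓ₂} (H : Ord.HeytingAlgebra c ℓ₁ ℓ₂) where
  open Ord.HeytingAlgebra H
  open HeytingAlgebraProperties H using (⇨-eval; ⇨-applyʳ; ⇨ʳ-covariant; y≤x⇨y)
  open HeytingAlgebraProperties H public using (¬_; ⇨-cong; de-morgan₁; ∧-distribˡ-∨)
  open MeetSemilatticeProperties meetSemilattice public
    using (∧-comm; ∧-cong; ∧-idempotent; ∧-monotonic)
  open JoinSemilatticeProperties joinSemilattice public using (∨-comm; ∨-cong)
  open BoundedMeetSemilatticeProperties boundedMeetSemilattice public using ()
    renaming (identityʳ to ∧-identityʳ)
  open BoundedJoinSemilatticeProperties boundedJoinSemilattice public using ()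
    renaming (identityˡ to ∨-identityˡ; identityʳ to ∨-identityʳ)

  ¬-cong : ∀ {x y} → x ≈ y → ¬ x ≈ ¬ y
  ¬-cong x≈y = ⇨-cong x≈y Eq.refl

  x∧¬x≈⊥ : ∀ x → x ∧ ¬ x ≈ ⊥
  x∧¬x≈⊥ x = antisym (⇨-applyʳ refl) (minimum _)

  ¬x∧x≈⊥ : ∀ x → ¬ x ∧ x ≈ ⊥
  ¬x∧x≈⊥ x = Eq.trans (∧-comm _ x) (x∧¬x≈⊥ x)

  ⊤⇨x≈x : ∀ x → ⊤ ⇨ x ≈ x
  ⊤⇨x≈x x = antisym (trans (reflexive (Eq.sym (∧-identityʳ _))) ⇨-eval) y≤x⇨y

  disjoint⇒y≤¬x : ∀ {x y} → x ∧ y ≈ ⊥ → y ≤ ¬ x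
  disjoint⇒y≤¬x {x} {y} x∧y≈⊥ = transpose-⇨ (reflexive (Eq.trans (∧-comm y x) x∧y≈⊥))

  disjoint⇒¬x∧y≈y : ∀ {x y} → x ∧ y ≈ ⊥ → ¬ x ∧ y ≈ y
  disjoint⇒¬x∧y≈y x∧y≈⊥ = antisym (x∧y≤y _ _) (∧-greatest (disjoint⇒y≤¬x x∧y≈⊥) refl)

  disjoint⇒x⇨y≈¬x : ∀ {x y} → x ∧ y ≈ ⊥ → x ⇨ y ≈ ¬ x
  disjoint⇒x⇨y≈¬x x∧y≈⊥ = antisym
    (transpose-⇨ (trans (∧-greatest (x∧y≤y _ _) ⇨-eval) (reflexive x∧y≈⊥)))
    (⇨ʳ-covariant (minimum _))

  complement⇒¬¬x≈¬y : ∀ {x y} → x ∧ y ≈ ⊥ → ¬ (x ∨ y) ≈ ⊥ → ¬ ¬ x ≈ ¬ y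
  complement⇒¬¬x≈¬y {x} {y} x∧y≈⊥ dense = antisym
    (transpose-⇨ (trans (∧-monotonic refl (disjoint⇒y≤¬x x∧y≈⊥)) ⇨-eval))
    (transpose-⇨ (reflexive (Eq.trans (∧-comm _ _) (Eq.trans (Eq.sym (de-morgan₁ x y)) dense))))

module NelsonLatticeProperties {c ℓ} (A : NelsonLattice c ℓ) where
  open NelsonLattice A

  *-commutativeMonoid : CommutativeMonoid c ℓ
  *-commutativeMonoid = record { isCommutativeMonoid = *-isCommutativeMonoid }

  open CommutativeMonoid *-commutativeMonoid using (commutativeSemigroup)
    renaming ( comm to *-comm; assoc to *-assoc; ∙-cong to *-cong
             ; identityˡ to *-identityˡ; identityʳ to *-identityʳ)
  open CommutativeSemigroupProperties commutativeSemigroup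
    using (interchange; xy∙z≈xz∙y; x∙yz≈y∙xz; x∙yz≈z∙yx; x∙yz≈xz∙y)

  lattice : Lattice c ℓ
  lattice = record { isLattice = isLattice }

  open Lattice lattice public using (setoid; refl; sym; trans; ∨-comm; ∧-cong; ∨-cong)
  open Ord.Lattice (∨-∧-orderTheoreticLattice lattice) public
    using (_≤_; poset; reflexive; antisym; x≤x∨y; y≤x∨y; ∨-least; x∧y≤x; x∧y≤y; ∧-greatest)
    renaming (refl to ≤-refl; trans to ≤-trans)
  open PartialOrderReasoning poset

  transpose-⇒ : ∀ {a b d} → a * b ≤ d → a ≤ b ⇒ d
  transpose-⇒ {a} {b} {d} a*b≤d = sym (residuation₁ a b d (sym a*b≤d))

  transpose-* : ∀ {a b d} → a ≤ b ⇒ d → a * b ≤ d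
  transpose-* {a} {b} {d} a≤b⇒d = sym (residuation₂ a b d (sym a≤b⇒d))

  ⊤-maximum : ∀ a → a ≤ ⊤
  ⊤-maximum a = sym (⊤-max a)

  ⊥-minimum : ∀ a → ⊥ ≤ a
  ⊥-minimum a = sym (⊥-min a)

  ⇒-eval : ∀ {a b} → (a ⇒ b) * a ≤ b
  ⇒-eval = transpose-* ≤-refl

  *-monoˡ-≤ : ∀ {a a′} b → a ≤ a′ → a * b ≤ a′ * b
  *-monoˡ-≤ b a≤a′ = transpose-* (≤-trans a≤a′ (transpose-⇒ ≤-refl))

  *-monoʳ-≤ : ∀ a {b b′} → b ≤ b′ → a * b ≤ a * b′
  *-monoʳ-≤ a {b} {b′} b≤b′ = begin
    a * b   ≈⟨ *-comm a b ⟩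
    b * a   ≤⟨ *-monoˡ-≤ a b≤b′ ⟩
    b′ * a  ≈⟨ *-comm b′ a ⟩
    a * b′  ∎

  *-mono-≤ : ∀ {a a′ b b′} → a ≤ a′ → b ≤ b′ → a * b ≤ a′ * b′
  *-mono-≤ {a′ = a′} {b = b} a≤a′ b≤b′ = ≤-trans (*-monoˡ-≤ b a≤a′) (*-monoʳ-≤ a′ b≤b′)

  x*y≤x : ∀ a b → a * b ≤ a
  x*y≤x a b = begin
    a * b  ≤⟨ *-monoʳ-≤ a (⊤-maximum b) ⟩
    a * ⊤  ≈⟨ *-identityʳ a ⟩
    a      ∎

  x*y≤y : ∀ a b → a * b ≤ b
  x*y≤y a b = ≤-trans (reflexive (*-comm a b)) (x*y≤x b a)

  ⇒ˡ-antitone : ∀ {a a′} b → a′ ≤ a → a ⇒ b ≤ a′ ⇒ b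
  ⇒ˡ-antitone b a′≤a = transpose-⇒ (≤-trans (*-monoʳ-≤ _ a′≤a) ⇒-eval)

  ⊤≤⇒⇒≤ : ∀ {a b} → ⊤ ≤ a ⇒ b → a ≤ b
  ⊤≤⇒⇒≤ {a} {b} ⊤≤a⇒b = begin
    a      ≈⟨ *-identityˡ a ⟨
    ⊤ * a  ≤⟨ transpose-* ⊤≤a⇒b ⟩
    b      ∎

  ≤⇒⊤≤⇒ : ∀ {a b} → a ≤ b → ⊤ ≤ a ⇒ b
  ≤⇒⊤≤⇒ {a} a≤b = transpose-⇒ (≤-trans (x*y≤y ⊤ a) a≤b)

  sq-cong : ∀ {a b} → a ≈ b → sq a ≈ sq b
  sq-cong a≈b = *-cong a≈b a≈b

  sq-mono-≤ : ∀ {a b} → a ≤ b → sq a ≤ sq b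
  sq-mono-≤ a≤b = *-mono-≤ a≤b a≤b

  sq≤x : ∀ a → sq a ≤ a
  sq≤x a = x*y≤x a a

  ∼-cong : ∀ {a b} → a ≈ b → ∼ a ≈ ∼ b
  ∼-cong a≈b = ⇒-cong a≈b refl

  ∼-antitone : ∀ {a b} → a ≤ b → ∼ b ≤ ∼ a
  ∼-antitone = ⇒ˡ-antitone ⊥

  ∼-galois : ∀ {a b} → a ≤ ∼ b → b ≤ ∼ a
  ∼-galois {a} {b} a≤∼b = transpose-⇒ (begin
    b * a  ≈⟨ *-comm b a ⟩
    a * b  ≤⟨ transpose-* a≤∼b ⟩
    ⊥      ∎)

  x*∼x≤⊥ : ∀ a → a * ∼ a ≤ ⊥
  x*∼x≤⊥ a = ≤-trans (reflexive (*-comm a (∼ a))) ⇒-eval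

  ∼⊤≈⊥ : ∼ ⊤ ≈ ⊥
  ∼⊤≈⊥ = antisym (≤-trans (reflexive (sym (*-identityʳ _))) ⇒-eval) (⊥-minimum _)

  ∼⊥≈⊤ : ∼ ⊥ ≈ ⊤
  ∼⊥≈⊤ = antisym (⊤-maximum _) (transpose-⇒ (x*y≤y ⊤ ⊥))

  sq⊥≈⊥ : sq ⊥ ≈ ⊥
  sq⊥≈⊥ = antisym (sq≤x ⊥) (⊥-minimum _)

  ∼-distrib-∨ : ∀ a b → ∼ (a ∨ b) ≈ ∼ a ∧ ∼ b
  ∼-distrib-∨ a b = antisym
    (∧-greatest (∼-antitone (x≤x∨y a b)) (∼-antitone (y≤x∨y a b)))
    (∼-galois (∨-least (∼-galois (x∧y≤x _ _)) (∼-galois (x∧y≤y _ _))))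

  ∼-distrib-∧ : ∀ a b → ∼ (a ∧ b) ≈ ∼ a ∨ ∼ b
  ∼-distrib-∧ a b = begin-equality
    ∼ (a ∧ b)              ≈⟨ ∼-cong (∧-cong (involutive a) (involutive b)) ⟨
    ∼ (∼ ∼ a ∧ ∼ ∼ b)      ≈⟨ ∼-cong (∼-distrib-∨ (∼ a) (∼ b)) ⟨
    ∼ ∼ (∼ a ∨ ∼ b)        ≈⟨ involutive _ ⟩
    ∼ a ∨ ∼ b              ∎

  ⇒≈∼[*∼] : ∀ a b → a ⇒ b ≈ ∼ (a * ∼ b)
  ⇒≈∼[*∼] a b = antisym
    (transpose-⇒ (begin
      (a ⇒ b) * (a * ∼ b)  ≈⟨ *-assoc _ _ _ ⟨
      ((a ⇒ b) * a) * ∼ b  ≤⟨ *-monoˡ-≤ (∼ b) ⇒-eval ⟩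
      b * ∼ b              ≤⟨ x*∼x≤⊥ b ⟩
      ⊥                    ∎))
    (transpose-⇒ (begin
      ∼ (a * ∼ b) * a      ≤⟨ transpose-⇒ (≤-trans (reflexive (*-assoc _ _ _)) ⇒-eval) ⟩
      ∼ ∼ b                ≈⟨ involutive b ⟩
      b                    ∎))

  ∼[⇒]≈*∼ : ∀ a b → ∼ (a ⇒ b) ≈ a * ∼ b
  ∼[⇒]≈*∼ a b = trans (∼-cong (⇒≈∼[*∼] a b)) (involutive _)

  ∼[*]≈⇒∼ : ∀ a b → ∼ (a * b) ≈ a ⇒ ∼ b
  ∼[*]≈⇒∼ a b = antisym
    (transpose-⇒ (transpose-⇒ (≤-trans (reflexive (*-assoc _ _ _)) ⇒-eval)))
    (transpose-⇒ (≤-trans (reflexive (sym (*-assoc _ _ _))) (transpose-* (transpose-* ≤-refl))))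

  contraposition : ∀ a b → a ⇒ b ≤ ∼ b ⇒ ∼ a
  contraposition a b = transpose-⇒ (transpose-⇒ (begin
    ((a ⇒ b) * ∼ b) * a  ≈⟨ xy∙z≈xz∙y _ _ _ ⟩
    ((a ⇒ b) * a) * ∼ b  ≤⟨ *-monoˡ-≤ (∼ b) ⇒-eval ⟩
    b * ∼ b              ≤⟨ x*∼x≤⊥ b ⟩
    ⊥                    ∎))

  nelson-≥ : ∀ a b → (sq a ⇒ b) ∧ (sq (∼ b) ⇒ ∼ a) ≤ a ⇒ b
  nelson-≥ a b = ⊤≤⇒⇒≤ (reflexive (sym (nelson a b)))

  ⇒-nelson : ∀ a b → a ⇒ b ≈ (sq a ⇒ b) ∧ (sq (∼ b) ⇒ ∼ a)
  ⇒-nelson a b = antisym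
    (∧-greatest (⇒ˡ-antitone b (sq≤x a)) (≤-trans (contraposition a b) (⇒ˡ-antitone (∼ a) (sq≤x _))))
    (nelson-≥ a b)

  nelson-≤ : ∀ {a b} → sq a ≤ b → sq (∼ b) ≤ ∼ a → a ≤ b
  nelson-≤ {a} {b} p q = ⊤≤⇒⇒≤ (≤-trans (∧-greatest (≤⇒⊤≤⇒ p) (≤⇒⊤≤⇒ q)) (nelson-≥ a b))

  ∼[*]-nelson : ∀ a b → ∼ (a * b) ≈ (sq a ⇒ ∼ b) ∧ (sq b ⇒ ∼ a)
  ∼[*]-nelson a b = begin-equality
    ∼ (a * b)                              ≈⟨ ∼[*]≈⇒∼ a b ⟩
    a ⇒ ∼ b                                ≈⟨ ⇒-nelson a (∼ b) ⟩
    (sq a ⇒ ∼ b) ∧ (sq (∼ ∼ b) ⇒ ∼ a)      ≈⟨ ∧-cong refl (⇒-cong (sq-cong (involutive b)) refl) ⟩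
    (sq a ⇒ ∼ b) ∧ (sq b ⇒ ∼ a)            ∎

  sq-∼-injective : ∀ {a b} → sq a ≈ sq b → sq (∼ a) ≈ sq (∼ b) → a ≈ b
  sq-∼-injective {a} {b} sq≈ sq∼≈ = antisym
    (nelson-≤ (≤-trans (reflexive sq≈) (sq≤x b)) (≤-trans (reflexive (sym sq∼≈)) (sq≤x (∼ a))))
    (nelson-≤ (≤-trans (reflexive (sym sq≈)) (sq≤x a)) (≤-trans (reflexive sq∼≈) (sq≤x (∼ b))))

  3-potent : ∀ a → sq a * a ≈ sq a
  3-potent a = antisym (x*y≤x (sq a) a) (transpose-* (nelson-≤ (transpose-⇒ ≤-refl) ∼-side))
    where
    cube = sq a * a
    ∼-side : sq (∼ (a ⇒ cube)) ≤ ∼ a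
    ∼-side = transpose-⇒ (begin
      sq (∼ (a ⇒ cube)) * a        ≈⟨ *-cong (sq-cong (∼[⇒]≈*∼ a cube)) refl ⟩
      sq (a * ∼ cube) * a          ≤⟨ *-monoˡ-≤ a (*-monoʳ-≤ (a * ∼ cube) (x*y≤x a (∼ cube))) ⟩
      ((a * ∼ cube) * a) * a       ≈⟨ *-cong (xy∙z≈xz∙y a (∼ cube) a) refl ⟩
      (sq a * ∼ cube) * a          ≈⟨ xy∙z≈xz∙y (sq a) (∼ cube) a ⟩
      cube * ∼ cube                ≤⟨ x*∼x≤⊥ cube ⟩
      ⊥                            ∎)

  sq-idempotent : ∀ a → sq (sq a) ≈ sq a
  sq-idempotent a = begin-equality
    sq a * sq a        ≈⟨ *-assoc (sq a) a a ⟨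
    (sq a * a) * a     ≈⟨ *-cong (3-potent a) refl ⟩
    sq a * a           ≈⟨ 3-potent a ⟩
    sq a               ∎

  sq-distrib-* : ∀ a b → sq (a * b) ≈ sq a * sq b
  sq-distrib-* a b = interchange a b a b

  sq-∧≈sq*sq : ∀ a b → sq (a ∧ b) ≈ sq a * sq b
  sq-∧≈sq*sq a b = antisym
    (begin
      sq (a ∧ b)           ≈⟨ sq-idempotent (a ∧ b) ⟨
      sq (sq (a ∧ b))      ≤⟨ *-mono-≤ (sq-mono-≤ (x∧y≤x a b)) (sq-mono-≤ (x∧y≤y a b)) ⟩
      sq a * sq b          ∎)
    (begin
      sq a * sq b          ≈⟨ *-cong (sq-idempotent a) (sq-idempotent b) ⟨
      sq (sq a) * sq (sq b) ≈⟨ sq-distrib-* (sq a) (sq b) ⟨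
      sq (sq a * sq b)     ≤⟨ sq-mono-≤ (∧-greatest (≤-trans (x*y≤x _ _) (sq≤x a))
                                                    (≤-trans (x*y≤y _ _) (sq≤x b))) ⟩
      sq (a ∧ b)           ∎)

  ∨-*-least : ∀ {x y a z} → x * a ≤ z → y * a ≤ z → (x ∨ y) * a ≤ z
  ∨-*-least x*a≤z y*a≤z = transpose-* (∨-least (transpose-⇒ x*a≤z) (transpose-⇒ y*a≤z))

  -- Every product of three factors from {x, y} repeats one of them.
  cube-∨-least : ∀ {x y z} → sq x ≤ z → sq y ≤ z → sq (x ∨ y) * (x ∨ y) ≤ z
  cube-∨-least {x} {y} {z} sqx≤z sqy≤z = begin
    sq (x ∨ y) * (x ∨ y)  ≈⟨ *-assoc _ _ _ ⟩
    (x ∨ y) * sq (x ∨ y)  ≤⟨ ∨-*-least (u*w*w≤z sqx≤z sqy≤z) y*w*w≤z ⟩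
    z                     ∎
    where
    sq*≤z : ∀ {u} t → sq u ≤ z → sq u * t ≤ z
    sq*≤z t squ≤z = ≤-trans (x*y≤x _ t) squ≤z

    u*w*w≤z : ∀ {u v} → sq u ≤ z → sq v ≤ z → u * sq (u ∨ v) ≤ z
    u*w*w≤z {u} {v} squ≤z sqv≤z = begin
      u * ((u ∨ v) * (u ∨ v))   ≈⟨ x∙yz≈y∙xz u _ _ ⟩
      (u ∨ v) * (u * (u ∨ v))   ≤⟨ ∨-*-least u*u*w≤z v*u*w≤z ⟩
      z                         ∎
      where
      u*u*w≤z : u * (u * (u ∨ v)) ≤ z
      u*u*w≤z = ≤-trans (reflexive (sym (*-assoc u u _))) (sq*≤z _ squ≤z)
      v*u*w≤z : v * (u * (u ∨ v)) ≤ z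
      v*u*w≤z = begin
        v * (u * (u ∨ v))       ≈⟨ x∙yz≈z∙yx v u _ ⟩
        (u ∨ v) * (u * v)       ≤⟨ ∨-*-least (≤-trans (reflexive (sym (*-assoc u u v))) (sq*≤z v squ≤z))
                                             (≤-trans (reflexive (x∙yz≈xz∙y v u v)) (sq*≤z u sqv≤z)) ⟩
        z                       ∎

    y*w*w≤z : y * sq (x ∨ y) ≤ z
    y*w*w≤z = ≤-trans (*-monoʳ-≤ y (reflexive (sq-cong (∨-comm x y)))) (u*w*w≤z sqy≤z sqx≤z)

  -- H = A / (a² = b²), presented as a setoid on A.
  infix  4 _≈ₕ_ _≤ₕ_
  infixr 5 _⇒ₕ_

  _≈ₕ_ : Carrier → Carrier → Set ℓ
  _≈ₕ_ = _≈_ on sq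

  _≤ₕ_ : Carrier → Carrier → Set ℓ
  a ≤ₕ b = sq a ≤ b

  _⇒ₕ_ : Carrier → Carrier → Carrier
  a ⇒ₕ b = sq a ⇒ b

  sq≈ₕx : ∀ a → sq a ≈ₕ a
  sq≈ₕx = sq-idempotent

  ≤ₕ⇒sq≤sq : ∀ {a b} → a ≤ₕ b → sq a ≤ sq b
  ≤ₕ⇒sq≤sq {a} a≤ₕb = ≤-trans (reflexive (sym (sq-idempotent a))) (sq-mono-≤ a≤ₕb)

  *≈ₕ∧ : ∀ a b → a * b ≈ₕ a ∧ b
  *≈ₕ∧ a b = trans (sq-distrib-* a b) (sym (sq-∧≈sq*sq a b))

  squareHeytingAlgebra : Ord.HeytingAlgebra c ℓ ℓ
  squareHeytingAlgebra = record
    { Carrier = Carrier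
    ; _≈_ = _≈ₕ_
    ; _≤_ = _≤ₕ_
    ; _∨_ = _∨_
    ; _∧_ = _∧_
    ; _⇨_ = _⇒ₕ_
    ; ⊤ = ⊤
    ; ⊥ = ⊥
    ; isHeytingAlgebra = record
      { isBoundedLattice = record
        { isLattice = record
          { isPartialOrder = record
            { isPreorder = record
              { isEquivalence = On.isEquivalence sq (Setoid.isEquivalence setoid)
              ; reflexive = λ {a} {b} a≈ₕb → ≤-trans (reflexive a≈ₕb) (sq≤x b)
              ; trans = λ a≤ₕb b≤ₕc → ≤-trans (≤ₕ⇒sq≤sq a≤ₕb) b≤ₕc
              }
            ; antisym = λ a≤ₕb b≤ₕa → antisym (≤ₕ⇒sq≤sq a≤ₕb) (≤ₕ⇒sq≤sq b≤ₕa)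
            }
          ; supremum = λ a b →
              ≤-trans (sq≤x a) (x≤x∨y a b) , ≤-trans (sq≤x b) (y≤x∨y a b) ,
              λ _ a≤ₕc b≤ₕc →
                ≤-trans (reflexive (sym (3-potent (a ∨ b)))) (cube-∨-least a≤ₕc b≤ₕc)
          ; infimum = λ a b →
              ≤-trans (sq≤x _) (x∧y≤x a b) , ≤-trans (sq≤x _) (x∧y≤y a b) ,
              λ _ → ∧-greatest
          }
        ; maximum = λ a → ⊤-maximum (sq a)
        ; minimum = λ a → ≤-trans (sq≤x ⊥) (⊥-minimum a)
        }
      ; exponential = λ a b d →
          (λ a∧b≤ₕd → transpose-⇒ (≤-trans (reflexive (sym (sq-∧≈sq*sq a b))) a∧b≤ₕd)) ,
          (λ a≤ₕb⇒ₕd → ≤-trans (reflexive (sq-∧≈sq*sq a b)) (transpose-* a≤ₕb⇒ₕd))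
      }
    }

module TwistProperties {c ℓ₁ ℓ₂} (M : ModalHeytingAlgebra c ℓ₁ ℓ₂) where
  open ModalHeytingAlgebra M using (heytingAlgebra)
  open Ord.HeytingAlgebra heytingAlgebra
  open HeytingAlgebraLemmas heytingAlgebra
  open Twist M

  ≈ₜ-setoid : Setoid c ℓ₁
  ≈ₜ-setoid = ×-setoid setoid setoid

  open SetoidReasoning ≈ₜ-setoid

  ∼ₜ : Pair → Pair
  ∼ₜ p = p ⇒ₜ ⊥ₜ

  sqₜ : Pair → Pair
  sqₜ p = p *ₜ p

  Δₜ : Pair → Pair
  Δₜ p = sqₜ (∼ₜ (sqₜ (∼ₜ p)))

  ∇ₜ : Pair → Pair
  ∇ₜ p = ∼ₜ (sqₜ (∼ₜ (sqₜ p)))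

  ⇒ₜ-cong : ∀ {p p′ q q′} → p ≈ₜ p′ → q ≈ₜ q′ → (p ⇒ₜ q) ≈ₜ (p′ ⇒ₜ q′)
  ⇒ₜ-cong (x≈ , y≈) (s≈ , t≈) = ∧-cong (⇨-cong x≈ s≈) (⇨-cong t≈ y≈) , ∧-cong x≈ t≈

  *ₜ-cong : ∀ {p p′ q q′} → p ≈ₜ p′ → q ≈ₜ q′ → (p *ₜ q) ≈ₜ (p′ *ₜ q′)
  *ₜ-cong (x≈ , y≈) (s≈ , t≈) = ∧-cong x≈ s≈ , ∧-cong (⇨-cong x≈ t≈) (⇨-cong s≈ y≈)

  ∼ₜ-cong : ∀ {p q} → p ≈ₜ q → ∼ₜ p ≈ₜ ∼ₜ q
  ∼ₜ-cong p≈q = ⇒ₜ-cong p≈q (Eq.refl , Eq.refl)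

  sqₜ-cong : ∀ {p q} → p ≈ₜ q → sqₜ p ≈ₜ sqₜ q
  sqₜ-cong p≈q = *ₜ-cong p≈q p≈q

  ∼ₜ-disjoint : ∀ {x y} → x ∧ y ≈ ⊥ → ∼ₜ (x , y) ≈ₜ (y , x)
  ∼ₜ-disjoint x∧y≈⊥ = Eq.trans (∧-cong Eq.refl (⊤⇨x≈x _)) (disjoint⇒¬x∧y≈y x∧y≈⊥) , ∧-identityʳ _

  sqₜ-disjoint : ∀ {x y} → x ∧ y ≈ ⊥ → sqₜ (x , y) ≈ₜ (x , ¬ x)
  sqₜ-disjoint x∧y≈⊥ = ∧-idempotent _ , Eq.trans (∧-idempotent _) (disjoint⇒x⇨y≈¬x x∧y≈⊥)

  Δₜ-disjoint : ∀ {x y} → x ∧ y ≈ ⊥ → Δₜ (x , y) ≈ₜ (¬ y , ¬ ¬ y)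
  Δₜ-disjoint {x} {y} x∧y≈⊥ = begin
    sqₜ (∼ₜ (sqₜ (∼ₜ (x , y))))  ≈⟨ sqₜ-cong (∼ₜ-cong (sqₜ-cong (∼ₜ-disjoint x∧y≈⊥))) ⟩
    sqₜ (∼ₜ (sqₜ (y , x)))       ≈⟨ sqₜ-cong (∼ₜ-cong (sqₜ-disjoint (Eq.trans (∧-comm y x) x∧y≈⊥))) ⟩
    sqₜ (∼ₜ (y , ¬ y))           ≈⟨ sqₜ-cong (∼ₜ-disjoint (x∧¬x≈⊥ y)) ⟩
    sqₜ (¬ y , y)                ≈⟨ sqₜ-disjoint (¬x∧x≈⊥ y) ⟩
    (¬ y , ¬ ¬ y)                ∎

  ∇ₜ-disjoint : ∀ {x y} → x ∧ y ≈ ⊥ → ∇ₜ (x , y) ≈ₜ (¬ ¬ x , ¬ x)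
  ∇ₜ-disjoint {x} {y} x∧y≈⊥ = begin
    ∼ₜ (sqₜ (∼ₜ (sqₜ (x , y))))  ≈⟨ ∼ₜ-cong (sqₜ-cong (∼ₜ-cong (sqₜ-disjoint x∧y≈⊥))) ⟩
    ∼ₜ (sqₜ (∼ₜ (x , ¬ x)))      ≈⟨ ∼ₜ-cong (sqₜ-cong (∼ₜ-disjoint (x∧¬x≈⊥ x))) ⟩
    ∼ₜ (sqₜ (¬ x , x))           ≈⟨ ∼ₜ-cong (sqₜ-disjoint (¬x∧x≈⊥ x)) ⟩
    ∼ₜ (¬ x , ¬ ¬ x)             ≈⟨ ∼ₜ-disjoint (x∧¬x≈⊥ (¬ x)) ⟩
    (¬ ¬ x , ¬ x)                ∎

  Δₜ≈∇ₜ : ∀ {p} → InTwist p → Δₜ p ≈ₜ ∇ₜ p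
  Δₜ≈∇ₜ {x , y} (x∧y≈⊥ , dense) = begin
    Δₜ (x , y)      ≈⟨ Δₜ-disjoint x∧y≈⊥ ⟩
    (¬ y , ¬ ¬ y)   ≈⟨ Eq.sym (complement⇒¬¬x≈¬y x∧y≈⊥ dense)
                     , complement⇒¬¬x≈¬y y∧x≈⊥ y∨x-dense ⟩
    (¬ ¬ x , ¬ x)   ≈⟨ ∇ₜ-disjoint x∧y≈⊥ ⟨
    ∇ₜ (x , y)      ∎
    where
    y∧x≈⊥ = Eq.trans (∧-comm y x) x∧y≈⊥
    y∨x-dense = Eq.trans (¬-cong (∨-comm y x)) dense

module TwistIsoProperties
  {c ℓ c′ ℓ₁ ℓ₂} {N : ModalNelsonLattice c ℓ} {M : ModalHeytingAlgebra c′ ℓ₁ ℓ₂} (I : TwistIso N M) where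
  open ModalNelsonLattice N
  open TwistIso I using (f; f-into; f-inj; f-*; f-⇒; f-⊥)
  open Twist M using (_≈ₜ_; _⇒ₜ_)
  open TwistProperties M
  open SetoidReasoning ≈ₜ-setoid

  f-∼ : ∀ a → f (∼ a) ≈ₜ ∼ₜ (f a)
  f-∼ a = begin
    f (a ⇒ ⊥)      ≈⟨ f-⇒ a ⊥ ⟩
    f a ⇒ₜ f ⊥     ≈⟨ ⇒ₜ-cong (Setoid.refl ≈ₜ-setoid) f-⊥ ⟩
    ∼ₜ (f a)       ∎

  f-sq : ∀ a → f (sq a) ≈ₜ sqₜ (f a)
  f-sq a = f-* a a

  f-Δ : ∀ a → f (Δ a) ≈ₜ Δₜ (f a)
  f-Δ a = begin
    f (sq (∼ sq (∼ a)))      ≈⟨ f-sq _ ⟩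
    sqₜ (f (∼ sq (∼ a)))     ≈⟨ sqₜ-cong (f-∼ _) ⟩
    sqₜ (∼ₜ (f (sq (∼ a))))  ≈⟨ sqₜ-cong (∼ₜ-cong (f-sq _)) ⟩
    sqₜ (∼ₜ (sqₜ (f (∼ a)))) ≈⟨ sqₜ-cong (∼ₜ-cong (sqₜ-cong (f-∼ a))) ⟩
    Δₜ (f a)                 ∎

  f-∇ : ∀ a → f (∇ a) ≈ₜ ∇ₜ (f a)
  f-∇ a = begin
    f (∼ sq (∼ sq a))        ≈⟨ f-∼ _ ⟩
    ∼ₜ (f (sq (∼ sq a)))     ≈⟨ ∼ₜ-cong (f-sq _) ⟩
    ∼ₜ (sqₜ (f (∼ sq a)))    ≈⟨ ∼ₜ-cong (sqₜ-cong (f-∼ _)) ⟩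
    ∼ₜ (sqₜ (∼ₜ (f (sq a)))) ≈⟨ ∼ₜ-cong (sqₜ-cong (∼ₜ-cong (f-sq a))) ⟩
    ∇ₜ (f a)                 ∎

  twistIso⇒Δ≈∇ : SatisfiesΔ≈∇ N
  twistIso⇒Δ≈∇ a = f-inj (begin
    f (Δ a)     ≈⟨ f-Δ a ⟩
    Δₜ (f a)    ≈⟨ Δₜ≈∇ₜ (f-into a) ⟩
    ∇ₜ (f a)    ≈⟨ f-∇ a ⟨
    f (∇ a)     ∎)

module ModalNelsonLatticeProperties {c ℓ} (N : ModalNelsonLattice c ℓ) where
  open ModalNelsonLattice N
  open NelsonLatticeProperties nelsonLattice
  module H where
    open Ord.HeytingAlgebra squareHeytingAlgebra public
    open HeytingAlgebraLemmas squareHeytingAlgebra public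
  open H using (¬_)

  ∼■≈◆∼ : ∀ a → ∼ ■ a ≈ ◆ (∼ a)
  ∼■≈◆∼ a = sym (trans (◆-def (∼ a)) (∼-cong (■-cong (involutive a))))

  ∼◆≈■∼ : ∀ a → ∼ ◆ a ≈ ■ (∼ a)
  ∼◆≈■∼ a = trans (∼-cong (◆-def a)) (involutive _)

  squareModalHeytingAlgebra : ModalHeytingAlgebra c ℓ ℓ
  squareModalHeytingAlgebra = record
    { heytingAlgebra = squareHeytingAlgebra
    ; □ = ■
    ; ◇ = ◆
    ; □-cong = λ {a} {b} → ■-sq a b
    ; ◇-cong = λ {a} {b} → ◆-sq a b
    ; modal = λ a b → trans (modal a b) (sym sq⊥≈⊥)
    }

  open Twist squareModalHeytingAlgebra using (InTwist; _≈ₜ_)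
  open SetoidReasoning H.setoid

  x∧∼x≈ₕ⊥ : ∀ a → a ∧ ∼ a ≈ₕ ⊥
  x∧∼x≈ₕ⊥ a = H.antisym (≤-trans (*-mono-≤ (x∧y≤x a (∼ a)) (x∧y≤y a (∼ a))) (x*∼x≤⊥ a)) (H.minimum _)

  -- The second disjunct of the witness is ⊥ in H, but it makes ∼ a equal to y there.
  twist-surjective : ∀ p → InTwist p → ∃ λ a → (a , ∼ a) ≈ₜ p
  twist-surjective (x , y) (x∧y≈ₕ⊥ , dense) = sq x ∨ (sq y ∧ ¬ y) , positive , negative
    where
    positive : sq x ∨ (sq y ∧ ¬ y) ≈ₕ x
    positive = begin
      sq x ∨ (sq y ∧ ¬ y)  ≈⟨ H.∨-cong (sq≈ₕx x) (H.∧-cong (sq≈ₕx y) H.Eq.refl) ⟩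
      x ∨ (y ∧ ¬ y)        ≈⟨ H.∨-cong H.Eq.refl (H.x∧¬x≈⊥ y) ⟩
      x ∨ ⊥                ≈⟨ H.∨-identityʳ x ⟩
      x                    ∎
    negative : ∼ (sq x ∨ (sq y ∧ ¬ y)) ≈ₕ y
    negative = begin
      ∼ (sq x ∨ (sq y ∧ ∼ sq y))  ≈⟨ sq-cong (∼-distrib-∨ _ _) ⟩
      ¬ x ∧ ∼ (sq y ∧ ∼ sq y)     ≈⟨ sq-cong (∧-cong refl (trans (∼-distrib-∧ _ _)
                                                               (∨-cong refl (involutive _)))) ⟩
      ¬ x ∧ (¬ y ∨ sq y)          ≈⟨ H.∧-cong H.Eq.refl (H.∨-cong H.Eq.refl (sq≈ₕx y)) ⟩
      ¬ x ∧ (¬ y ∨ y)             ≈⟨ H.∧-distribˡ-∨ _ _ _ ⟩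
      (¬ x ∧ ¬ y) ∨ (¬ x ∧ y)     ≈⟨ H.∨-cong (H.Eq.sym (H.de-morgan₁ x y))
                                              (H.disjoint⇒¬x∧y≈y x∧y≈ₕ⊥) ⟩
      ¬ (x ∨ y) ∨ y               ≈⟨ H.∨-cong dense H.Eq.refl ⟩
      ⊥ ∨ y                       ≈⟨ H.∨-identityˡ y ⟩
      y                           ∎

  module _ (Δ≈∇ : SatisfiesΔ≈∇ N) where

    ¬∼≈ₕ¬¬ : ∀ a → ¬ (∼ a) ≈ₕ ¬ ¬ a
    ¬∼≈ₕ¬¬ a = trans (sym (sq-idempotent _)) (sq-cong (Δ≈∇ a))

    x∨∼x-dense : ∀ a → ¬ (a ∨ ∼ a) ≈ₕ ⊥
    x∨∼x-dense a = begin
      ¬ (a ∨ ∼ a)    ≈⟨ H.de-morgan₁ a (∼ a) ⟩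
      ¬ a ∧ ¬ ∼ a    ≈⟨ H.∧-cong H.Eq.refl (¬∼≈ₕ¬¬ a) ⟩
      ¬ a ∧ ¬ ¬ a    ≈⟨ H.x∧¬x≈⊥ (¬ a) ⟩
      ⊥              ∎

    squareConditions : Theorem9Conditions squareModalHeytingAlgebra
    squareConditions = □-condition , ◇-condition
      where
      □-condition : ∀ a → ¬ ¬ ■ a ≈ₕ ¬ ◆ (¬ a)
      □-condition a = begin
        ¬ ¬ ■ a           ≈⟨ H.¬-cong (H.¬-cong (■-sq a (sq a) (sym (sq-idempotent a)))) ⟩
        ¬ ¬ ■ (sq a)      ≈⟨ ¬∼≈ₕ¬¬ (■ (sq a)) ⟨
        ¬ ∼ ■ (sq a)      ≈⟨ H.¬-cong (sq-cong (∼■≈◆∼ (sq a))) ⟩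
        ¬ ◆ (¬ a)         ∎
      ◇-condition : ∀ a → ¬ ■ (¬ a) ≈ₕ ¬ ¬ ◆ a
      ◇-condition a = begin
        ¬ ■ (¬ a)         ≈⟨ H.¬-cong (sq-cong (involutive _)) ⟨
        ¬ ∼ ∼ ■ (¬ a)     ≈⟨ ¬∼≈ₕ¬¬ (∼ ■ (¬ a)) ⟩
        ¬ ¬ ∼ ■ (¬ a)     ≈⟨ H.¬-cong (H.¬-cong (sq-cong (sym (◆-def (sq a))))) ⟩
        ¬ ¬ ◆ (sq a)      ≈⟨ H.¬-cong (H.¬-cong (◆-sq (sq a) a (sq-idempotent a))) ⟩
        ¬ ¬ ◆ a           ∎

    squareTwistIso : TwistIso N squareModalHeytingAlgebra
    squareTwistIso = record
      { f      = λ a → a , ∼ a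
      ; f-into = λ a → x∧∼x≈ₕ⊥ a , x∨∼x-dense a
      ; f-cong = λ a≈b → sq-cong a≈b , sq-cong (∼-cong a≈b)
      ; f-inj  = λ (a≈ₕb , ∼a≈ₕ∼b) → sq-∼-injective a≈ₕb ∼a≈ₕ∼b
      ; f-surj = twist-surjective
      ; f-∧    = λ a b → refl , sq-cong (∼-distrib-∧ a b)
      ; f-∨    = λ a b → refl , sq-cong (∼-distrib-∨ a b)
      ; f-*    = λ a b → *≈ₕ∧ a b , sq-cong (∼[*]-nelson a b)
      ; f-⇒    = λ a b → sq-cong (⇒-nelson a b) , trans (sq-cong (∼[⇒]≈*∼ a b)) (*≈ₕ∧ a (∼ b))
      ; f-⊤    = refl , sq-cong ∼⊤≈⊥
      ; f-⊥    = refl , sq-cong ∼⊥≈⊤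
      ; f-■    = λ a → refl , sq-cong (∼■≈◆∼ a)
      ; f-◆    = λ a → refl , sq-cong (∼◆≈■∼ a)
      }

theorem9 : ∀ {c ℓ} (N : ModalNelsonLattice c ℓ) →
    SatisfiesΔ≈∇ N ⇔
      Σ (ModalHeytingAlgebra c ℓ ℓ) (λ M → Theorem9Conditions M × TwistIso N M)
theorem9 N = mk⇔
  (λ Δ≈∇ → squareModalHeytingAlgebra , squareConditions Δ≈∇ , squareTwistIso Δ≈∇)
  (λ (_ , _ , I) → TwistIsoProperties.twistIso⇒Δ≈∇ I)
  where open ModalNelsonLatticeProperties N
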